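{- Let $G$ be a (not necessarily finite) group with Cayley table $L$ (rows and columns indexed by $G$, cell $(g,h)$ containing $gh$). Let $m$ be a positive integer and let $R$ be the submatrix of $L$ with rows indexed by a finite set $X\subseteq G$ and columns indexed by a finite set $Y\subseteq G$, where $|X|=\alpha m$, $|Y|=\beta m$ and $\frac12<\alpha\le\beta\le 1$, and suppose $R$ contains exactly $m$ distinct symbols. If $\frac{\alpha}{2}+\beta>1$, then $R$ is contained in an $m\times m$ subsquare of $L$.
   Context: An $m\times m$ subsquare of $L$ is a submatrix of $L$, with rows indexed by some $X'\subseteq G$ and columns indexed by some $Y'\subseteq G$, $|X'|=|Y'|=m$, which is itself a Latin square of order $m$ (i.e., contains exactly $m$ distinct symbols). $R$ is contained in it if $X\subseteq X'$ and $Y\subseteq Y'$. -}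

module Defs where

open import Level using (Level; _⊔_)
open import Algebra.Bundles using (Group)
open import Data.Nat using (ℕ)
open import Data.List using (List; length)
open import Data.Product using (Σ; _×_; ∃₂; _,_; proj₁)
open import Relation.Binary.PropositionalEquality using (_≡_)
import Data.List.Membership.Setoid as Mem
import Data.List.Relation.Unary.Unique.Setoid as Uniq

module CayleyTable {c ℓ : Level} (G : Group c ℓ) where
  open Group G

  open Mem setoid public using (_∈_)
  open Uniq setoid public using (Unique)

  FinSubset : Set (c ⊔ ℓ)
  FinSubset = Σ (List Carrier) Unique

  size : FinSubset → ℕ
  size (xs , _) = length xs

  _⊆_ : FinSubset → FinSubset → Set (c ⊔ ℓ)
  (xs , _) ⊆ (ys , _) = ∀ {x} → x ∈ xs → x ∈ ys

  IsSymbol : FinSubset → FinSubset → Carrier → Set (c ⊔ ℓ)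
  IsSymbol (xs , _) (ys , _) z = ∃₂ λ x y → x ∈ xs × y ∈ ys × (x ∙ y) ≈ z

  HasExactlySymbols : FinSubset → FinSubset → ℕ → Set (c ⊔ ℓ)
  HasExactlySymbols X Y k =
    Σ FinSubset λ S → size S ≡ k ×
      ((∀ z → IsSymbol X Y z → z ∈ proj₁ S) ×
       (∀ {z} → z ∈ proj₁ S → IsSymbol X Y z))

  -- an m×m subsquare of L: rows X', cols Y', |X'| = |Y'| = m,
  -- and L[X',Y'] is a Latin square of order m (contains exactly m symbols)
  SubsquareContaining : ℕ → FinSubset → FinSubset → Set (c ⊔ ℓ)
  SubsquareContaining m X Y =
    Σ FinSubset λ X' → Σ FinSubset λ Y' →
      size X' ≡ m × size Y' ≡ m × HasExactlySymbols X' Y' m × X ⊆ X' × Y ⊆ Y'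

{-# OPTIONS --safe #-}
-- Write a = |X|, b = |Y|, u = m for the number of symbols, and let D = {x⁻¹x' : x, x' ∈ X}.
-- Since 2a > u, any two columns of R share a symbol, so yy'⁻¹ ∈ D for all y, y' ∈ Y.
-- Any two rows x, x' share at least 2b − u symbols, i.e. x⁻¹x' maps at least 2b − u
-- elements of Y into Y; as a + 2b > 2u, two such sets of elements meet, which makes D
-- closed under multiplication. Each γ ∈ D has at least 2b − u translation pairs (y, γy) in
-- Y × Y and distinct γ have disjoint sets of pairs, so |D| ≤ b² / (2b − u) < a + b. Hence for
-- g ∈ D the a distinct elements x₀⁻¹x and the b distinct elements gy₀y⁻¹ of D collide,
-- giving xy = x₀gy₀ for some cell: x₀Dy₀ is exactly the symbol set S, and the rows Sy₀⁻¹
-- and columns x₀⁻¹S span the required m × m subsquare.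
module Submission where

open import Defs
open import Level using (Level)
open import Algebra.Bundles using (Group)
import Algebra.Properties.Group as GroupProperties
open import Data.Nat using (ℕ; zero; suc; _+_; _*_; _∸_; _≤_; _<_; _≤?_; z≤n; s≤s)
open import Data.Nat.Properties
  using ( ≰⇒>; <⇒≱; <⇒≤; ≤-trans; <-≤-trans; m≤m+n; +-suc; +-comm; +-identityʳ
        ; +-mono-≤; +-monoˡ-≤; +-monoˡ-<; +-cancelˡ-<; *-monoˡ-≤; *-distribʳ-+; ∸-monoʳ-≤
        ; m+n∸n≡m; m+n∸m≡n; m+[n∸m]≡n; [m+n]∸[m+o]≡n∸o; m≤n⇒∃[o]m+o≡n; module ≤-Reasoning)
open import Data.Nat.Tactic.RingSolver using (solve-∀)
open import Data.Fin using (Fin; zero; suc; combine)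
import Data.Fin.Properties as Fin
open import Data.List
  using (List; []; _∷_; length; map; _++_; filter; allFin; lookup; concat; tabulate)
open import Data.List.Properties using (length-++; length-map; length-tabulate)
import Data.List.Relation.Unary.All as All
import Data.List.Relation.Unary.All.Properties as All
open import Data.List.Relation.Unary.Any as Any using (any?)
open import Data.List.Relation.Unary.Any.Properties using (mapWith∈⁻; lookup-index; tabulate⁻)
open import Data.List.Relation.Unary.AllPairs using (_∷_)
import Data.List.Relation.Unary.AllPairs.Properties as AllPairs
open import Data.List.Relation.Unary.Unique.Propositional using (Unique)
import Data.List.Relation.Unary.Unique.Propositional.Properties as Unique
import Data.List.Relation.Unary.Unique.Setoid.Properties as SetoidUnique
open import Data.List.Relation.Binary.Disjoint.Propositional using (Disjoint)
open import Data.List.Membership.Propositional using (_∈_; mapWith∈; find; lose)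
open import Data.List.Membership.Propositional.Properties
  using (∈-lookup; ∈-map⁻; ∈-filter⁻; map-mapWith∈; mapWith∈-id; ∈-tabulate⁻; ∈-concat⁻)
import Data.List.Membership.DecPropositional as DecMembership
import Data.List.Membership.Setoid.Properties as SetoidMembership
open import Data.Product using (∃; ∃₂; _×_; _,_; proj₁; proj₂)
import Data.Product.Properties as Product
open import Data.Empty using (⊥-elim)
open import Function using (_∘_; Injective)
open import Relation.Binary using (Setoid)
import Relation.Binary.Reasoning.Setoid as ≈-Reasoning
open import Relation.Binary.PropositionalEquality as ≡ using (_≡_)
open import Relation.Nullary using (yes; no; contradiction)
open import Relation.Unary using (Pred; Decidable)
open import Relation.Unary.Properties using (∁?)

module _ {s ℓ} (S : Setoid s ℓ) where
  open Setoid S using (_≈_) renaming (sym to ≈-sym)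
  open import Data.List.Relation.Unary.Unique.Setoid S using () renaming (Unique to Unique≈)

  lookup-injective : ∀ {xs} → Unique≈ xs → ∀ {i j} → lookup xs i ≈ lookup xs j → i ≡ j
  lookup-injective (_ ∷ _)  {zero}  {zero}  _   = ≡.refl
  lookup-injective (x≉ ∷ _) {zero}  {suc j} x≈y = ⊥-elim (All.lookup x≉ (∈-lookup j) x≈y)
  lookup-injective (x≉ ∷ _) {suc i} {zero}  y≈x = ⊥-elim (All.lookup x≉ (∈-lookup i) (≈-sym y≈x))
  lookup-injective (_ ∷ u)  {suc i} {suc j} eq  = ≡.cong suc (lookup-injective u eq)

length-allFin : ∀ n → length (allFin n) ≡ n
length-allFin n = length-tabulate {n = n} (λ i → i)

Unique⇒length≤ : ∀ {n} {xs : List (Fin n)} → Unique xs → length xs ≤ n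
Unique⇒length≤ {n} {xs} xs! with length xs ≤? n
... | yes ≤n = ≤n
... | no ≰n with i , j , i<j , eq ← Fin.pigeonhole (≰⇒> ≰n) (lookup xs) =
  contradiction (lookup-injective (≡.setoid _) xs! eq) (Fin.<⇒≢ i<j)

common-element : ∀ {n} {xs ys : List (Fin n)} → Unique xs → Unique ys →
                 n < length xs + length ys → ∃ λ z → z ∈ xs × z ∈ ys
common-element {n} {xs} {ys} xs! ys! n< with any? (λ x → DecMembership._∈?_ Fin._≟_ x ys) xs
... | yes some = find some
... | no none = contradiction (Unique⇒length≤ (Unique.++⁺ xs! ys! disjoint))
                              (<⇒≱ (≡.subst (n <_) (≡.sym (length-++ xs)) n<))
  where
  disjoint : Disjoint xs ys
  disjoint (z∈xs , z∈ys) = none (lose z∈xs z∈ys)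

length-filter+length-filter-∁ : ∀ {a p} {A : Set a} {P : Pred A p} (P? : Decidable P) xs →
  length (filter P? xs) + length (filter (∁? P?) xs) ≡ length xs
length-filter+length-filter-∁ P? []       = ≡.refl
length-filter+length-filter-∁ P? (x ∷ xs) with P? x
... | yes _ = ≡.cong suc (length-filter+length-filter-∁ P? xs)
... | no  _ = ≡.trans (+-suc (length (filter P? xs)) (length (filter (∁? P?) xs)))
                     (≡.cong suc (length-filter+length-filter-∁ P? xs))

length-concat-tabulate-≥ : ∀ {a} {A : Set a} {n k} (F : Fin n → List A) →
  (∀ i → k ≤ length (F i)) → n * k ≤ length (concat (tabulate F))
length-concat-tabulate-≥ {n = zero}  F k≤ = z≤n
length-concat-tabulate-≥ {n = suc n} F k≤ = begin
  _ + n * _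
    ≤⟨ +-mono-≤ (k≤ zero) (length-concat-tabulate-≥ (F ∘ suc) (k≤ ∘ suc)) ⟩
  length (F zero) + length (concat (tabulate (F ∘ suc)))
    ≡⟨ length-++ (F zero) ⟨
  length (concat (tabulate F))
    ∎
  where open ≤-Reasoning

module _ {b u} (f g : Fin b → Fin u) where

  HitsImage : Pred (Fin b) _
  HitsImage j = ∃ λ j' → f j' ≡ g j

  hitsImage? : Decidable HitsImage
  hitsImage? j = Fin.any? λ j' → f j' Fin.≟ g j

  coincidences : List (Fin b)
  coincidences = filter hitsImage? (allFin b)

  ∈-coincidences⁻ : ∀ {j} → j ∈ coincidences → HitsImage j
  ∈-coincidences⁻ = proj₂ ∘ ∈-filter⁻ hitsImage? {xs = allFin b}

  coincidences-unique : Unique coincidences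
  coincidences-unique = Unique.filter⁺ hitsImage? (Unique.allFin⁺ b)

  coincidences-length : Injective _≡_ _≡_ f → Injective _≡_ _≡_ g →
                        b + b ∸ u ≤ length coincidences
  coincidences-length f-inj g-inj = begin
    b + b ∸ u                              ≤⟨ ∸-monoʳ-≤ (b + b) image-bound ⟩
    b + b ∸ (b + m)                        ≡⟨ [m+n]∸[m+o]≡n∸o b b m ⟩
    b ∸ m                                  ≡⟨ ≡.cong (_∸ m) partition ⟨
    length coincidences + m ∸ m            ≡⟨ m+n∸n≡m (length coincidences) m ⟩
    length coincidences                    ∎
    where
    open ≤-Reasoning
    misses : List (Fin b)
    misses = filter (∁? hitsImage?) (allFin b)
    m = length misses
    partition : length coincidences + m ≡ b
    partition = ≡.trans (length-filter+length-filter-∁ hitsImage? (allFin b)) (length-allFin b)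
    disjoint : Disjoint (map f (allFin b)) (map g misses)
    disjoint (z∈f , z∈g) with ∈-map⁻ f z∈f | ∈-map⁻ g z∈g
    ... | j' , _ , ≡.refl | j , j∈ , fj'≡gj =
      proj₂ (∈-filter⁻ (∁? hitsImage?) {xs = allFin b} j∈) (j' , fj'≡gj)
    image-bound : b + m ≤ u
    image-bound = ≡.subst (_≤ u) lengths (Unique⇒length≤ (Unique.++⁺
      (Unique.map⁺ f-inj (Unique.allFin⁺ b))
      (Unique.map⁺ g-inj (Unique.filter⁺ (∁? hitsImage?) (Unique.allFin⁺ b)))
      disjoint))
      where
      lengths : length (map f (allFin b) ++ map g misses) ≡ b + m
      lengths = ≡.trans (length-++ (map f (allFin b)))
        (≡.cong₂ _+_ (≡.trans (length-map f (allFin b)) (length-allFin b)) (length-map g misses))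

  matches : List (Fin b × Fin b)
  matches = mapWith∈ coincidences (λ {j} j∈ → j , proj₁ (∈-coincidences⁻ j∈))

  ∈-matches⁻ : ∀ {j j'} → (j , j') ∈ matches → f j' ≡ g j
  ∈-matches⁻ jj'∈ with mapWith∈⁻ coincidences _ jj'∈
  ... | j , j∈ , ≡.refl = proj₂ (∈-coincidences⁻ j∈)

  matches-unique : Unique matches
  matches-unique = Unique.map⁻ (≡.subst Unique (≡.sym proj₁-matches) coincidences-unique)
    where
    proj₁-matches : map proj₁ matches ≡ coincidences
    proj₁-matches = ≡.trans (map-mapWith∈ coincidences _ proj₁) (mapWith∈-id coincidences)

  matches-length : Injective _≡_ _≡_ f → Injective _≡_ _≡_ g → b + b ∸ u ≤ length matches
  matches-length f-inj g-inj = ≡.subst (b + b ∸ u ≤_)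
    (≡.sym (SetoidMembership.length-mapWith∈ (≡.setoid _) coincidences))
    (coincidences-length f-inj g-inj)

Unique⇒length≤-pairs : ∀ {m n} {ps : List (Fin m × Fin n)} → Unique ps → length ps ≤ m * n
Unique⇒length≤-pairs {m} {n} {ps} ps! =
  ≡.subst (_≤ m * n) (length-map pair-index ps)
    (Unique⇒length≤ (Unique.map⁺ pair-index-injective ps!))
  where
  pair-index : Fin m × Fin n → Fin (m * n)
  pair-index (i , j) = combine i j
  pair-index-injective : Injective _≡_ _≡_ pair-index
  pair-index-injective {i , j} {k , l} eq
    with ≡.refl , ≡.refl ← Fin.combine-injective i j k l eq = ≡.refl

private
  split-excess : ∀ {a b u} → a ≤ b → b ≤ u → 2 * u < a + 2 * b →
                 ∃₂ λ c d → u ≡ c + d + c × b ≡ c + d × c + c < a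
  split-excess {a} {b} {u} a≤b b≤u 2u<a+2b = c , b ∸ c , u≡ , b≡ , 2c<a
    where
    c = u ∸ b
    2c<a : c + c < a
    2c<a = +-cancelˡ-< (b + b) (c + c) a (begin-strict
      b + b + (c + c) ≡⟨ rearrange b c ⟩
      2 * (b + c)     ≡⟨ ≡.cong (2 *_) (m+[n∸m]≡n b≤u) ⟩
      2 * u           <⟨ 2u<a+2b ⟩
      a + 2 * b       ≡⟨ +-comm a (2 * b) ⟩
      2 * b + a       ≡⟨ ≡.cong (_+ a) (≡.cong (b +_) (+-identityʳ b)) ⟩
      b + b + a       ∎)
      where
      open ≤-Reasoning
      rearrange : ∀ x y → x + x + (y + y) ≡ 2 * (x + y)
      rearrange = solve-∀
    b≡ : b ≡ c + (b ∸ c)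
    b≡ = ≡.sym (m+[n∸m]≡n (≤-trans (m≤m+n c c) (≤-trans (<⇒≤ 2c<a) a≤b)))
    u≡ : u ≡ c + (b ∸ c) + c
    u≡ = ≡.trans (≡.sym (m+[n∸m]≡n b≤u)) (≡.cong (_+ c) b≡)

  double-excess : ∀ c d → c + d + (c + d) ∸ (c + d + c) ≡ d
  double-excess c d = ≡.trans ([m+n]∸[m+o]≡n∸o (c + d) (c + d) c) (m+n∸m≡n c d)

b<[b+b∸u]+[b+b∸u] : ∀ {a b u} → a ≤ b → b ≤ u → 2 * u < a + 2 * b → b < (b + b ∸ u) + (b + b ∸ u)
b<[b+b∸u]+[b+b∸u] a≤b b≤u 2u<a+2b
  with c , d , ≡.refl , ≡.refl , 2c<a ← split-excess a≤b b≤u 2u<a+2b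
  rewrite double-excess c d = +-monoˡ-< d (+-cancelˡ-< c c d (<-≤-trans 2c<a a≤b))

b*b<[a+b]*[b+b∸u] : ∀ {a b u} → a ≤ b → b ≤ u → 2 * u < a + 2 * b → b * b < (a + b) * (b + b ∸ u)
b*b<[a+b]*[b+b∸u] {a} a≤b b≤u 2u<a+2b
  with c , d , ≡.refl , ≡.refl , 2c<a ← split-excess a≤b b≤u 2u<a+2b
  rewrite double-excess c d
  with q , ≡.refl ← m≤n⇒∃[o]m+o≡n (+-cancelˡ-< c c d (<-≤-trans 2c<a a≤b)) = begin-strict
    (c + d) * (c + d)                          <⟨ s≤s (m≤m+n _ _) ⟩
    suc ((c + d) * (c + d) + (c * q + c + c + q)) ≡⟨ expand c q ⟩
    (suc (c + c) + (c + d)) * d                ≤⟨ *-monoˡ-≤ d (+-monoˡ-≤ (c + d) 2c<a) ⟩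
    (a + (c + d)) * d                          ∎
  where
  open ≤-Reasoning
  expand : ∀ c q → let d = suc (c + q) in
           suc ((c + d) * (c + d) + (c * q + c + c + q)) ≡ (suc (c + c) + (c + d)) * d
  expand = solve-∀

module CayleyRectangle {c ℓ} (G : Group c ℓ) where
  open Group G
  open CayleyTable G renaming (_∈_ to _∈ₛ_; Unique to Uniqueₛ)
  open GroupProperties G
    using ( ∙-cancelʳ; ∙-cancelˡ; ⁻¹-injective; y≈x\\z; x≈z//y
          ; \\-leftDividesˡ; \\-leftDividesʳ; //-rightDividesˡ; //-rightDividesʳ)

  cross-quotient : ∀ {x y x' y'} → x ∙ y ≈ x' ∙ y' → y ≈ (x ⁻¹ ∙ x') ∙ y'
  cross-quotient {x} {y} {x'} {y'} eq = begin
    y               ≈⟨ y≈x\\z x y (x' ∙ y') eq ⟩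
    x ⁻¹ ∙ (x' ∙ y') ≈⟨ assoc (x ⁻¹) x' y' ⟨
    (x ⁻¹ ∙ x') ∙ y' ∎
    where open ≈-Reasoning setoid

  quotients-match : ∀ {x x' g y y'} → x ⁻¹ ∙ x' ≈ g ∙ (y ∙ y' ⁻¹) → x' ∙ y' ≈ (x ∙ g) ∙ y
  quotients-match {x} {x'} {g} {y} {y'} eq = begin
    x' ∙ y'                           ≈⟨ ∙-congʳ (\\-leftDividesˡ x x') ⟨
    (x ∙ (x ⁻¹ ∙ x')) ∙ y'            ≈⟨ ∙-congʳ (∙-congˡ eq) ⟩
    (x ∙ (g ∙ (y ∙ y' ⁻¹))) ∙ y'      ≈⟨ ∙-congʳ (assoc x g (y ∙ y' ⁻¹)) ⟨
    ((x ∙ g) ∙ (y ∙ y' ⁻¹)) ∙ y'      ≈⟨ assoc (x ∙ g) (y ∙ y' ⁻¹) y' ⟩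
    (x ∙ g) ∙ ((y ∙ y' ⁻¹) ∙ y')      ≈⟨ ∙-congˡ (//-rightDividesˡ y' y) ⟩
    (x ∙ g) ∙ y                       ∎
    where open ≈-Reasoning setoid

  module Rectangle {xs ys ss : List Carrier} (xs! : Uniqueₛ xs) (ys! : Uniqueₛ ys)
    (complete : ∀ z → IsSymbol (xs , xs!) (ys , ys!) z → z ∈ₛ ss) where

    a b u : ℕ
    a = length xs
    b = length ys
    u = length ss

    X : Fin a → Carrier
    X = lookup xs
    Y : Fin b → Carrier
    Y = lookup ys
    S : Fin u → Carrier
    S = lookup ss

    cell-∈ : ∀ i j → X i ∙ Y j ∈ₛ ss
    cell-∈ i j = complete (X i ∙ Y j)
      (X i , Y j , SetoidMembership.∈-lookup setoid xs i ,
       SetoidMembership.∈-lookup setoid ys j , refl)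

    -- ρ i j is the position in ss of the symbol X i ∙ Y j; working with these
    -- indices makes equality of cells decidable although ≈ need not be.
    ρ : Fin a → Fin b → Fin u
    ρ i j = Any.index (cell-∈ i j)

    ρ-≡⇒≈ : ∀ {i j i' j'} → ρ i j ≡ ρ i' j' → X i ∙ Y j ≈ X i' ∙ Y j'
    ρ-≡⇒≈ {i} {j} {i'} {j'} eq = begin
      X i ∙ Y j   ≈⟨ lookup-index (cell-∈ i j) ⟩
      S (ρ i j)   ≡⟨ ≡.cong S eq ⟩
      S (ρ i' j') ≈⟨ lookup-index (cell-∈ i' j') ⟨
      X i' ∙ Y j' ∎
      where open ≈-Reasoning setoid

    ρ-injectiveʳ : ∀ i → Injective _≡_ _≡_ (ρ i)
    ρ-injectiveʳ i eq = lookup-injective setoid ys! (∙-cancelˡ (X i) _ _ (ρ-≡⇒≈ eq))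

    ρ-injectiveˡ : ∀ j → Injective _≡_ _≡_ (λ i → ρ i j)
    ρ-injectiveˡ j eq = lookup-injective setoid xs! (∙-cancelʳ (Y j) _ _ (ρ-≡⇒≈ eq))

    column : Fin b → List (Fin u)
    column j = tabulate (λ i → ρ i j)

    column-unique : ∀ j → Unique (column j)
    column-unique j = Unique.tabulate⁺ (ρ-injectiveˡ j)

    length-column : ∀ j → length (column j) ≡ a
    length-column j = length-tabulate (λ i → ρ i j)

    RowQuotient : Pred Carrier ℓ
    RowQuotient z = ∃₂ λ i i' → z ≈ X i ⁻¹ ∙ X i'

    RowQuotient-resp : ∀ {z w} → z ≈ w → RowQuotient w → RowQuotient z
    RowQuotient-resp z≈w (i , i' , w≈) = i , i' , trans z≈w w≈

    Translates : Carrier → Fin b × Fin b → Set ℓ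
    Translates γ (j , j') = Y j' ≈ γ ∙ Y j

    translates-unique : ∀ {γ γ' p} → Translates γ p → Translates γ' p → γ ≈ γ'
    translates-unique {γ} {γ'} {j , _} γY γ'Y = ∙-cancelʳ (Y j) γ γ' (trans (sym γY) γ'Y)

    ∈-matches⇒translates : ∀ {i i' p} → p ∈ matches (ρ i) (ρ i') → Translates (X i ⁻¹ ∙ X i') p
    ∈-matches⇒translates p∈ = cross-quotient (ρ-≡⇒≈ (∈-matches⁻ _ _ p∈))

    pairs : ∀ {γ} → RowQuotient γ → List (Fin b × Fin b)
    pairs (i , i' , _) = matches (ρ i) (ρ i')

    ∈-pairs⇒translates : ∀ {γ} (γ∈ : RowQuotient γ) {p} → p ∈ pairs γ∈ → Translates γ p
    ∈-pairs⇒translates (i , i' , γ≈) p∈ = trans (∈-matches⇒translates p∈) (∙-congʳ (sym γ≈))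

    pairs-unique : ∀ {γ} (γ∈ : RowQuotient γ) → Unique (pairs γ∈)
    pairs-unique (i , i' , _) = matches-unique (ρ i) (ρ i')

    pairs-length : ∀ {γ} (γ∈ : RowQuotient γ) → b + b ∸ u ≤ length (pairs γ∈)
    pairs-length (i , i' , _) = matches-length (ρ i) (ρ i') (ρ-injectiveʳ i) (ρ-injectiveʳ i')

    module _ {n} {γ : Fin n → Carrier} (γ∈ : ∀ i → RowQuotient (γ i)) where

      familyPairs : List (Fin b × Fin b)
      familyPairs = concat (tabulate (pairs ∘ γ∈))

      ∈-familyPairs⇒translates : ∀ {p} → p ∈ familyPairs → ∃ λ i → Translates (γ i) p
      ∈-familyPairs⇒translates p∈
        with i , p∈i ← tabulate⁻ (∈-concat⁻ (tabulate (pairs ∘ γ∈)) p∈) =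
        i , ∈-pairs⇒translates (γ∈ i) p∈i

      familyPairs-unique : (∀ {i i'} → γ i ≈ γ i' → i ≡ i') → Unique familyPairs
      familyPairs-unique γ-injective = Unique.concat⁺ (All.tabulate⁺ (pairs-unique ∘ γ∈))
        (AllPairs.tabulate⁺ λ i≢i' (p∈i , p∈i') → i≢i' (γ-injective
          (translates-unique (∈-pairs⇒translates (γ∈ _) p∈i) (∈-pairs⇒translates (γ∈ _) p∈i'))))

      familyPairs-length : n * (b + b ∸ u) ≤ length familyPairs
      familyPairs-length = length-concat-tabulate-≥ (pairs ∘ γ∈) (pairs-length ∘ γ∈)

    familyPairs-++-length : ∀ {n n'} {α : Fin n → Carrier} {β : Fin n' → Carrier}
      (α∈ : ∀ i → RowQuotient (α i)) (β∈ : ∀ j → RowQuotient (β j)) →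
      (n + n') * (b + b ∸ u) ≤ length (familyPairs α∈ ++ familyPairs β∈)
    familyPairs-++-length {n} {n'} α∈ β∈ = begin
      (n + n') * (b + b ∸ u)
        ≡⟨ *-distribʳ-+ (b + b ∸ u) n n' ⟩
      n * (b + b ∸ u) + n' * (b + b ∸ u)
        ≤⟨ +-mono-≤ (familyPairs-length α∈) (familyPairs-length β∈) ⟩
      length (familyPairs α∈) + length (familyPairs β∈)
        ≡⟨ length-++ (familyPairs α∈) ⟨
      length (familyPairs α∈ ++ familyPairs β∈)
        ∎
      where open ≤-Reasoning

    families-meet : ∀ {n n'} {α : Fin n → Carrier} {β : Fin n' → Carrier} →
      (∀ {i i'} → α i ≈ α i' → i ≡ i') → (∀ {j j'} → β j ≈ β j' → j ≡ j') →
      (α∈ : ∀ i → RowQuotient (α i)) (β∈ : ∀ j → RowQuotient (β j)) →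
      b * b < (n + n') * (b + b ∸ u) → ∃₂ λ i j → α i ≈ β j
    families-meet α-inj β-inj α∈ β∈ b*b<
      with any? (λ p → DecMembership._∈?_ (Product.≡-dec Fin._≟_ Fin._≟_) p (familyPairs β∈))
                (familyPairs α∈)
    ... | yes collision with p , p∈α , p∈β ← find collision
      with i , αi ← ∈-familyPairs⇒translates α∈ p∈α | j , βj ← ∈-familyPairs⇒translates β∈ p∈β =
      i , j , translates-unique αi βj
    ... | no none = contradiction
      (Unique⇒length≤-pairs (Unique.++⁺ (familyPairs-unique α∈ α-inj) (familyPairs-unique β∈ β-inj)
        (λ (p∈α , p∈β) → none (lose p∈α p∈β))))
      (<⇒≱ (<-≤-trans b*b< (familyPairs-++-length α∈ β∈)))

    module _ (u<2a : u < 2 * a) where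

      columns-exceed : ∀ j j' → u < length (column j) + length (column j')
      columns-exceed j j' rewrite length-column j | length-column j' | +-identityʳ a = u<2a

      column-quotient : ∀ j j' → RowQuotient (Y j ∙ Y j' ⁻¹)
      column-quotient j j'
        with z , z∈j , z∈j' ←
               common-element (column-unique j) (column-unique j') (columns-exceed j j')
        with i , ≡.refl ← ∈-tabulate⁻ z∈j | i' , eq ← ∈-tabulate⁻ z∈j' =
        i , i' , sym (x≈z//y _ (Y j') (Y j) (sym (cross-quotient (ρ-≡⇒≈ eq))))

      module _ (a≤b : a ≤ b) (b≤u : b ≤ u) (2u<a+2b : 2 * u < a + 2 * b) where

        coincidences-exceed : ∀ i i' k k' →
          b < length (coincidences (ρ i) (ρ i')) + length (coincidences (ρ k) (ρ k'))
        coincidences-exceed i i' k k' = <-≤-trans (b<[b+b∸u]+[b+b∸u] a≤b b≤u 2u<a+2b)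
          (+-mono-≤ (coincidences-length (ρ i) (ρ i') (ρ-injectiveʳ i) (ρ-injectiveʳ i'))
                    (coincidences-length (ρ k) (ρ k') (ρ-injectiveʳ k) (ρ-injectiveʳ k')))

        RowQuotient-∙ : ∀ {g h} → RowQuotient g → RowQuotient h → RowQuotient (g ∙ h)
        RowQuotient-∙ {g} {h} (i , i' , g≈) (k , k' , h≈)
          with j , j∈g , j∈h ← common-element (coincidences-unique (ρ i) (ρ i'))
                                 (coincidences-unique (ρ k') (ρ k)) (coincidences-exceed i i' k' k)
          with j₁ , eq₁ ← ∈-coincidences⁻ (ρ i) (ρ i') j∈g
             | j₂ , eq₂ ← ∈-coincidences⁻ (ρ k') (ρ k) j∈h =
          RowQuotient-resp (x≈z//y (g ∙ h) (Y j₂) (Y j₁) gh-translates) (column-quotient j₁ j₂)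
          where
          open ≈-Reasoning setoid
          gh-translates : (g ∙ h) ∙ Y j₂ ≈ Y j₁
          gh-translates = begin
            (g ∙ h) ∙ Y j₂
              ≈⟨ assoc g h (Y j₂) ⟩
            g ∙ (h ∙ Y j₂)
              ≈⟨ ∙-cong g≈ (∙-congʳ h≈) ⟩
            (X i ⁻¹ ∙ X i') ∙ ((X k ⁻¹ ∙ X k') ∙ Y j₂)
              ≈⟨ ∙-congˡ (cross-quotient (ρ-≡⇒≈ (≡.sym eq₂))) ⟨
            (X i ⁻¹ ∙ X i') ∙ Y j
              ≈⟨ cross-quotient (ρ-≡⇒≈ eq₁) ⟨
            Y j₁
              ∎

        quotients-meet : ∀ i₀ j₀ {g} → RowQuotient g →
                         ∃₂ λ i j → X i₀ ⁻¹ ∙ X i ≈ g ∙ (Y j₀ ∙ Y j ⁻¹)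
        quotients-meet i₀ j₀ {g} g∈ = families-meet α-injective β-injective
          (λ i → i₀ , i , refl) (λ j → RowQuotient-∙ g∈ (column-quotient j₀ j))
          (b*b<[a+b]*[b+b∸u] a≤b b≤u 2u<a+2b)
          where
          α-injective : ∀ {i i'} → X i₀ ⁻¹ ∙ X i ≈ X i₀ ⁻¹ ∙ X i' → i ≡ i'
          α-injective eq = lookup-injective setoid xs! (∙-cancelˡ (X i₀ ⁻¹) _ _ eq)
          β-injective : ∀ {j j'} → g ∙ (Y j₀ ∙ Y j ⁻¹) ≈ g ∙ (Y j₀ ∙ Y j' ⁻¹) → j ≡ j'
          β-injective eq = lookup-injective setoid ys!
            (⁻¹-injective (∙-cancelˡ (Y j₀) _ _ (∙-cancelˡ g _ _ eq)))

        shifted-quotient-∈ : ∀ i₀ j₀ {g} → RowQuotient g → (X i₀ ∙ g) ∙ Y j₀ ∈ₛ ss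
        shifted-quotient-∈ i₀ j₀ g∈ =
          let i , j , eq = quotients-meet i₀ j₀ g∈ in
          SetoidMembership.∈-resp-≈ setoid (quotients-match eq) (cell-∈ i j)

        module Subsquare (ss! : Uniqueₛ ss)
          (sound : ∀ {z} → z ∈ₛ ss → IsSymbol (xs , xs!) (ys , ys!) z)
          (i₀ : Fin a) (j₀ : Fin b) where

          x₀ y₀ : Carrier
          x₀ = X i₀
          y₀ = Y j₀

          shift : Carrier → Carrier
          shift s = x₀ ⁻¹ ∙ (s ∙ y₀ ⁻¹)

          shift-quotient : ∀ {s} → s ∈ₛ ss → RowQuotient (shift s)
          shift-quotient {s} s∈ with x , y , x∈ , y∈ , xy≈s ← sound s∈ =
            RowQuotient-resp shift≈ (RowQuotient-∙ (i₀ , i , refl) (column-quotient j j₀))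
            where
            open ≈-Reasoning setoid
            i = Any.index x∈
            j = Any.index y∈
            shift≈ : shift s ≈ (x₀ ⁻¹ ∙ X i) ∙ (Y j ∙ y₀ ⁻¹)
            shift≈ = begin
              x₀ ⁻¹ ∙ (s ∙ y₀ ⁻¹)
                ≈⟨ ∙-congˡ (∙-congʳ xy≈s) ⟨
              x₀ ⁻¹ ∙ ((x ∙ y) ∙ y₀ ⁻¹)
                ≈⟨ ∙-congˡ (∙-congʳ (∙-cong (lookup-index x∈) (lookup-index y∈))) ⟩
              x₀ ⁻¹ ∙ ((X i ∙ Y j) ∙ y₀ ⁻¹)
                ≈⟨ ∙-congˡ (assoc (X i) (Y j) (y₀ ⁻¹)) ⟩
              x₀ ⁻¹ ∙ (X i ∙ (Y j ∙ y₀ ⁻¹))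
                ≈⟨ assoc (x₀ ⁻¹) (X i) (Y j ∙ y₀ ⁻¹) ⟨
              (x₀ ⁻¹ ∙ X i) ∙ (Y j ∙ y₀ ⁻¹)
                ∎

          rows cols : FinSubset
          rows = map (_∙ y₀ ⁻¹) ss , SetoidUnique.map⁺ setoid setoid (∙-cancelʳ (y₀ ⁻¹) _ _) ss!
          cols = map (x₀ ⁻¹ ∙_) ss , SetoidUnique.map⁺ setoid setoid (∙-cancelˡ (x₀ ⁻¹) _ _) ss!

          subsquare-complete : ∀ z → IsSymbol rows cols z → z ∈ₛ ss
          subsquare-complete z (x' , y' , x'∈ , y'∈ , x'y'≈z)
            with s , s∈ , x'≈ ← SetoidMembership.∈-map⁻ setoid setoid x'∈
               | s' , s'∈ , y'≈ ← SetoidMembership.∈-map⁻ setoid setoid y'∈ =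
            SetoidMembership.∈-resp-≈ setoid z≈
              (shifted-quotient-∈ i₀ j₀ (RowQuotient-∙ (shift-quotient s∈) (shift-quotient s'∈)))
            where
            open ≈-Reasoning setoid
            z≈ : (x₀ ∙ (shift s ∙ shift s')) ∙ y₀ ≈ z
            z≈ = begin
              (x₀ ∙ (shift s ∙ shift s')) ∙ y₀
                ≈⟨ ∙-congʳ (assoc x₀ (shift s) (shift s')) ⟨
              ((x₀ ∙ shift s) ∙ shift s') ∙ y₀
                ≈⟨ assoc (x₀ ∙ shift s) (shift s') y₀ ⟩
              (x₀ ∙ shift s) ∙ (shift s' ∙ y₀)
                ≈⟨ ∙-cong (\\-leftDividesˡ x₀ (s ∙ y₀ ⁻¹)) (assoc (x₀ ⁻¹) (s' ∙ y₀ ⁻¹) y₀) ⟩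
              (s ∙ y₀ ⁻¹) ∙ (x₀ ⁻¹ ∙ ((s' ∙ y₀ ⁻¹) ∙ y₀))
                ≈⟨ ∙-congˡ (∙-congˡ (//-rightDividesˡ y₀ s')) ⟩
              (s ∙ y₀ ⁻¹) ∙ (x₀ ⁻¹ ∙ s')
                ≈⟨ ∙-cong x'≈ y'≈ ⟨
              x' ∙ y'
                ≈⟨ x'y'≈z ⟩
              z
                ∎

          subsquare-sound : ∀ {z} → z ∈ₛ ss → IsSymbol rows cols z
          subsquare-sound {z} z∈ =
            z ∙ y₀ ⁻¹ , x₀ ⁻¹ ∙ (x₀ ∙ y₀) ,
            SetoidMembership.∈-map⁺ setoid setoid ∙-congʳ z∈ ,
            SetoidMembership.∈-map⁺ setoid setoid ∙-congˡ (cell-∈ i₀ j₀) ,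
            trans (∙-congˡ (\\-leftDividesʳ x₀ y₀)) (//-rightDividesˡ y₀ z)

          xs⊆rows : (xs , xs!) ⊆ rows
          xs⊆rows {x} x∈ = SetoidMembership.∈-resp-≈ setoid (//-rightDividesʳ y₀ x)
            (SetoidMembership.∈-map⁺ setoid setoid ∙-congʳ
              (complete (x ∙ y₀) (x , y₀ , x∈ , SetoidMembership.∈-lookup setoid ys j₀ , refl)))

          ys⊆cols : (ys , ys!) ⊆ cols
          ys⊆cols {y} y∈ = SetoidMembership.∈-resp-≈ setoid (\\-leftDividesʳ x₀ y)
            (SetoidMembership.∈-map⁺ setoid setoid ∙-congˡ
              (complete (x₀ ∙ y) (x₀ , y , SetoidMembership.∈-lookup setoid xs i₀ , y∈ , refl)))

          subsquare : SubsquareContaining u (xs , xs!) (ys , ys!)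
          subsquare = rows , cols , length-map _ ss , length-map _ ss ,
            ((ss , ss!) , ≡.refl , subsquare-complete , subsquare-sound) , xs⊆rows , ys⊆cols

theorem4p8 : {c ℓ : Level} (G : Group c ℓ) (m : ℕ) (X Y : CayleyTable.FinSubset G) →
    1 ≤ m →
    m < 2 * CayleyTable.size G X →
    CayleyTable.size G X ≤ CayleyTable.size G Y →
    CayleyTable.size G Y ≤ m →
    CayleyTable.HasExactlySymbols G X Y m →
    2 * m < CayleyTable.size G X + 2 * CayleyTable.size G Y →
    CayleyTable.SubsquareContaining G m X Y
theorem4p8 G m ([] , _) _ _ () _ _ _ _
theorem4p8 G m (_ ∷ _ , _) ([] , _) _ _ () _ _ _
theorem4p8 G m (_ ∷ _ , xs!) (_ ∷ _ , ys!) _ m<2a a≤b b≤m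
           ((ss , ss!) , ≡.refl , complete , sound) 2m<a+2b = subsquare
  where
  open CayleyRectangle.Rectangle G xs! ys! complete
  open Subsquare m<2a a≤b b≤m 2m<a+2b ss! sound zero zero
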